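{- For every small step alternating pushdown system $\mathcal I$ one can build an inference system $\tilde{\mathcal I}$ proving exactly the same configurations as $\mathcal I$, and a set $\mathcal C$ of atomic propositions, such that the conclusion of every rule of $\tilde{\mathcal I}$ belongs to $\mathcal C$ and for every configuration $A$ there exists a unique proposition $B\in\mathcal C$ such that $A$ is an instance of $B$.
   Context: Fix a language with finitely many unary predicate symbols (states), finitely many unary function symbols (stack symbols), a constant $\varepsilon$ and a variable $x$. Words are closed terms $\gamma_1(\cdots\gamma_n(\varepsilon))$; configurations are atomic propositions $P(w)$ with $P$ a state and $w$ a word; an instance of a proposition is obtained by substituting a word for $x$. An inference system is a set of rules $\frac{A_1\cdots A_n}{B}$ with atomic premises and conclusion; a proof of a configuration is a finite tree labeled by configurations where each node is labeled $\sigma B$ and its children $\sigma A_1,\dots,\sigma A_n$ for some rule and substitution $\sigma$. Rule types: an introduction rule is $\frac{P_1(x)\cdots P_n(x)}{Q(\gamma x)}$ ($\gamma$ a stack symbol, $n\ge0$) or $\frac{}{Q(\varepsilon)}$; an elimination rule is $\frac{P_1(\gamma x)\ P_2(x)\cdots P_n(x)}{Q(x)}$ ($n\ge1$); a neutral rule is $\frac{P_1(x)\cdots P_n(x)}{Q(x)}$ ($n\ge0$). A small step alternating pushdown system is a finite set of introduction, elimination and neutral rules. -}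

module Defs where

open import Data.Nat using (ℕ)
open import Data.Fin using (Fin)
open import Data.List using (List; []; _∷_)
import Data.List
open import Data.List.Relation.Unary.All using (All)
open import Data.List.Relation.Unary.Any using (Any)
open import Data.List.Membership.Propositional using (_∈_)
open import Data.Product using (Σ; _×_; _,_; ∃; ∃-syntax)
open import Relation.Binary.PropositionalEquality using (_≡_)

-- A language with `nS` states (unary predicate symbols) and `nΓ` stack
-- symbols (unary function symbols), a constant ε and one variable x.
module Language (nS nΓ : ℕ) where

  State : Set
  State = Fin nS

  Sym : Set
  Sym = Fin nΓ

  data Term : Set where
    ε   : Term
    var : Term
    _·_ : Sym → Term → Term

  data Word : Set where
    ε   : Word
    _·_ : Sym → Word → Word

  record Prop : Set where
    constructor _⟨_⟩
    field
      pred : State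
      arg  : Term

  record Config : Set where
    constructor _⟨_⟩
    field
      pred : State
      arg  : Word

  substT : Word → Term → Word
  substT w ε       = ε
  substT w var     = w
  substT w (γ · t) = γ · substT w t

  subst : Word → Prop → Config
  subst w (P ⟨ t ⟩) = P ⟨ substT w t ⟩

  InstanceOf : Config → Prop → Set
  InstanceOf A B = ∃[ w ] subst w B ≡ A

  record Rule : Set where
    constructor _⇒_
    field
      premises   : List Prop
      conclusion : Prop
  open Rule public

  InferenceSystem : Set
  InferenceSystem = List Rule

  data Proof (I : InferenceSystem) : Config → Set where
    node : (r : Rule) → r ∈ I → (w : Word) →
           All (λ A → Proof I (subst w A)) (premises r) →
           Proof I (subst w (conclusion r))

  Provable : InferenceSystem → Config → Set
  Provable = Proof

  data Introduction : Rule → Set where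
    intro-γ : (Ps : List State) (γ : Sym) (Q : State) →
              Introduction (Data.List.map (λ P → P ⟨ var ⟩) Ps ⇒ (Q ⟨ γ · var ⟩))
    intro-ε : (Q : State) → Introduction ([] ⇒ (Q ⟨ ε ⟩))

  data Elimination : Rule → Set where
    elim : (P₁ : State) (γ : Sym) (Ps : List State) (Q : State) →
           Elimination (((P₁ ⟨ γ · var ⟩) ∷ Data.List.map (λ P → P ⟨ var ⟩) Ps)
                         ⇒ (Q ⟨ var ⟩))

  data Neutral : Rule → Set where
    neutral : (Ps : List State) (Q : State) →
              Neutral (Data.List.map (λ P → P ⟨ var ⟩) Ps ⇒ (Q ⟨ var ⟩))

  data SmallStepRule (r : Rule) : Set where
    is-intro   : Introduction r → SmallStepRule r
    is-elim    : Elimination r → SmallStepRule r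
    is-neutral : Neutral r → SmallStepRule r

  SmallStepAPDS : InferenceSystem → Set
  SmallStepAPDS I = All SmallStepRule I

-- Call a term *simple* if it is ε or γ·x; every word is an instance
-- of exactly one simple term, so the simple propositions P(ε), P(γ·x) form
-- the set C.  The conclusion of a small step rule is Q(ε), Q(γ·x) or Q(x);
-- only the last is not simple, and we replace such a rule by its instances
-- at x := ε and x := γ·x for every stack symbol γ (all other rules are
-- kept).  The new system Ĩ proves the same configurations because
--   * every rule of Ĩ is an instance of a rule of I, hence derivable in I;
--   * every instance of a rule of I is an instance of a rule of Ĩ.
module Submission where

open import Defs
open import Data.Nat using (ℕ)
open import Data.List using (List; []; _∷_; map; concatMap; allFin; cartesianProductWith)
open import Data.List.Relation.Unary.All using (All; []; _∷_)
import Data.List.Relation.Unary.All as All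
import Data.List.Relation.Unary.All.Properties as AllP
import Data.List.Relation.Unary.Any as Any
open import Data.List.Relation.Unary.Any using (here; there)
open import Data.List.Membership.Propositional using (_∈_; find)
open import Data.List.Membership.Propositional.Properties
  using (∈-map⁺; ∈-map⁻; ∈-allFin; ∈-concatMap⁺; ∈-concatMap⁻;
         ∈-cartesianProductWith⁺; ∈-cartesianProductWith⁻)
open import Data.Product using (Σ; _×_; _,_)
open import Relation.Binary.PropositionalEquality using (_≡_; refl; cong; sym)
import Relation.Binary.PropositionalEquality as Eq

module Saturation (nS nΓ : ℕ) where
  open Language nS nΓ

  substTerm : Term → Term → Term
  substTerm s ε       = ε
  substTerm s var     = s
  substTerm s (γ · t) = γ · substTerm s t

  substProp : Term → Prop → Prop
  substProp s (P ⟨ t ⟩) = P ⟨ substTerm s t ⟩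

  instRule : Term → Rule → Rule
  instRule s (As ⇒ B) = map (substProp s) As ⇒ substProp s B

  substT-comp : ∀ w s t → substT w (substTerm s t) ≡ substT (substT w s) t
  substT-comp w s ε       = refl
  substT-comp w s var     = refl
  substT-comp w s (γ · t) = cong (γ ·_) (substT-comp w s t)

  subst-comp : ∀ w s A → subst w (substProp s A) ≡ subst (substT w s) A
  subst-comp w s (P ⟨ t ⟩) = cong (P ⟨_⟩) (substT-comp w s t)

  Derivable : InferenceSystem → Rule → Set
  Derivable J r = (w : Word) → All (λ A → Proof J (subst w A)) (premises r) →
                  Proof J (subst w (conclusion r))

  module _ {I J : InferenceSystem} (derive : ∀ {r} → r ∈ I → Derivable J r) where
    mutual
      simulate : ∀ {A} → Proof I A → Proof J A
      simulate (node r r∈I w children) = derive r∈I w (simulateAll children)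

      simulateAll : ∀ {w As} → All (λ A → Proof I (subst w A)) As →
                    All (λ A → Proof J (subst w A)) As
      simulateAll []       = []
      simulateAll (p ∷ ps) = simulate p ∷ simulateAll ps

  instance-derivable : ∀ {I r} → r ∈ I → (s : Term) → Derivable I (instRule s r)
  instance-derivable {I} {As ⇒ B} r∈I s w children =
    Eq.subst (Proof I) (sym (subst-comp w s B))
      (node (As ⇒ B) r∈I (substT w s)
        (All.map (λ {A} → Eq.subst (Proof I) (subst-comp w s A)) (AllP.map⁻ children)))

  covered-derivable : ∀ {J r} →
    ((w : Word) → Σ Term λ s → Σ Word λ w′ → instRule s r ∈ J × substT w′ s ≡ w) →
    Derivable J r
  covered-derivable {J} {As ⇒ B} cover w children with cover w
  ... | s , w′ , inst∈J , refl =
    Eq.subst (Proof J) (subst-comp w′ s B)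
      (node (instRule s (As ⇒ B)) inst∈J w′
        (AllP.map⁺ (All.map (λ {A} → Eq.subst (Proof J) (sym (subst-comp w′ s A))) children)))

  data Simple : Term → Set where
    ε-simple : Simple ε
    γ-simple : ∀ γ → Simple (γ · var)

  simpleTerms : List Term
  simpleTerms = ε ∷ map (_· var) (allFin nΓ)

  simple∈simpleTerms : ∀ {t} → Simple t → t ∈ simpleTerms
  simple∈simpleTerms ε-simple     = here refl
  simple∈simpleTerms (γ-simple γ) = there (∈-map⁺ (_· var) (∈-allFin γ))

  simpleTerms-simple : ∀ {t} → t ∈ simpleTerms → Simple t
  simpleTerms-simple (here refl) = ε-simple
  simpleTerms-simple (there t∈) with γ , _ , refl ← ∈-map⁻ (_· var) t∈ = γ-simple γ

  shapeOf : Word → Term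
  shapeOf ε       = ε
  shapeOf (γ · w) = γ · var

  simple-unique : ∀ {t} w → Simple t → t ≡ shapeOf (substT w t)
  simple-unique w ε-simple     = refl
  simple-unique w (γ-simple γ) = refl

  data Shallow : Term → Set where
    var-shallow    : Shallow var
    simple-shallow : ∀ {t} → Simple t → Shallow t

  splitting : Term → List Term
  splitting var     = simpleTerms
  splitting ε       = var ∷ []
  splitting (γ · t) = var ∷ []

  splitting-covers : ∀ t w → Σ Term λ s → Σ Word λ w′ → s ∈ splitting t × substT w′ s ≡ w
  splitting-covers var ε       = ε , ε , here refl , refl
  splitting-covers var (γ · w) = γ · var , w , simple∈simpleTerms (γ-simple γ) , refl
  splitting-covers ε       w = var , w , here refl , refl
  splitting-covers (γ · t) w = var , w , here refl , refl

  splitting-simple : ∀ {t s} → Shallow t → s ∈ splitting t → Simple (substTerm s t)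
  splitting-simple var-shallow s∈ = simpleTerms-simple s∈
  splitting-simple (simple-shallow ε-simple)     (here refl) = ε-simple
  splitting-simple (simple-shallow (γ-simple γ)) (here refl) = γ-simple γ

  expand : Rule → List Rule
  expand r = map (λ s → instRule s r) (splitting (Prop.arg (conclusion r)))

  saturate : InferenceSystem → InferenceSystem
  saturate = concatMap expand

  saturate-instances : ∀ {I r′} → r′ ∈ saturate I →
    Σ Rule λ r → Σ Term λ s → r ∈ I × s ∈ splitting (Prop.arg (conclusion r)) × r′ ≡ instRule s r
  saturate-instances {I} r′∈
    with r , r∈I , r′∈expand ← find (∈-concatMap⁻ expand {xs = I} r′∈)
    with s , s∈ , refl ← ∈-map⁻ (λ s → instRule s r) r′∈expand
    = r , s , r∈I , s∈ , refl

  -- Each rule of I is covered by its split instances, all of which are in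
  -- the saturated system.
  saturate-complete : ∀ {I A} → Proof I A → Proof (saturate I) A
  saturate-complete {I} = simulate derive
    where
    derive : ∀ {r} → r ∈ I → Derivable (saturate I) r
    derive {r} r∈I = covered-derivable λ w →
      let s , w′ , s∈ , eq = splitting-covers (Prop.arg (conclusion r)) w
          inst∈expand = ∈-map⁺ (λ s → instRule s r) s∈
      in s , w′ , ∈-concatMap⁺ expand (Any.map (λ { refl → inst∈expand }) r∈I) , eq

  saturate-sound : ∀ {I A} → Proof (saturate I) A → Proof I A
  saturate-sound {I} = simulate derive
    where
    derive : ∀ {r′} → r′ ∈ saturate I → Derivable I r′
    derive r′∈ with r , s , r∈I , _ , refl ← saturate-instances {I} r′∈ =
      instance-derivable r∈I s

  simpleProps : List Prop
  simpleProps = cartesianProductWith _⟨_⟩ (allFin nS) simpleTerms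

  simple∈simpleProps : ∀ P {t} → Simple t → (P ⟨ t ⟩) ∈ simpleProps
  simple∈simpleProps P t-simple =
    ∈-cartesianProductWith⁺ _⟨_⟩ (∈-allFin P) (simple∈simpleTerms t-simple)

  simpleProps-simple : ∀ {B} → B ∈ simpleProps → Simple (Prop.arg B)
  simpleProps-simple B∈
    with _ , _ , _ , t∈ , refl ← ∈-cartesianProductWith⁻ _⟨_⟩ (allFin nS) simpleTerms B∈
    = simpleTerms-simple t∈

  saturate-conclusions : ∀ {I} → All (λ r → Shallow (Prop.arg (conclusion r))) I →
                         All (λ r → conclusion r ∈ simpleProps) (saturate I)
  saturate-conclusions {I} shallow = All.tabulate conclusion-simple
    where
    conclusion-simple : ∀ {r′} → r′ ∈ saturate I → conclusion r′ ∈ simpleProps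
    conclusion-simple r′∈ with As ⇒ (Q ⟨ t ⟩) , s , r∈I , s∈ , refl ← saturate-instances {I} r′∈ =
      simple∈simpleProps Q (splitting-simple (All.lookup shallow r∈I) s∈)

  small-step-shallow : ∀ {r} → SmallStepRule r → Shallow (Prop.arg (conclusion r))
  small-step-shallow (is-intro (intro-γ Ps γ Q)) = simple-shallow (γ-simple γ)
  small-step-shallow (is-intro (intro-ε Q))      = simple-shallow ε-simple
  small-step-shallow (is-elim (elim P₁ γ Ps Q))  = var-shallow
  small-step-shallow (is-neutral (neutral Ps Q)) = var-shallow

  unique-simple-pattern : (A : Config) → Σ Prop λ B → (B ∈ simpleProps × InstanceOf A B)
                          × ((B′ : Prop) → B′ ∈ simpleProps → InstanceOf A B′ → B′ ≡ B)
  unique-simple-pattern (P ⟨ w ⟩) =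
    (P ⟨ shapeOf w ⟩) , (simple∈simpleProps P (shape-simple w) , shape-instance w) , unique
    where
    shape-simple : ∀ w → Simple (shapeOf w)
    shape-simple ε       = ε-simple
    shape-simple (γ · w) = γ-simple γ

    shape-instance : ∀ w → InstanceOf (P ⟨ w ⟩) (P ⟨ shapeOf w ⟩)
    shape-instance ε       = ε , refl
    shape-instance (γ · w) = w , refl

    unique : (B′ : Prop) → B′ ∈ simpleProps → InstanceOf (P ⟨ w ⟩) B′ → B′ ≡ (P ⟨ shapeOf w ⟩)
    unique (.P ⟨ t ⟩) B′∈ (w′ , refl) = cong (P ⟨_⟩) (simple-unique w′ (simpleProps-simple B′∈))

lemma7 : (nS nΓ : ℕ) → let open Language nS nΓ in
    (I : InferenceSystem) → SmallStepAPDS I →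
    Σ InferenceSystem λ Ĩ → Σ (List Prop) λ C →
      ((A : Config) → (Provable I A → Provable Ĩ A) × (Provable Ĩ A → Provable I A))
      × All (λ r → conclusion r ∈ C) Ĩ
      × ((A : Config) → Σ Prop λ B → (B ∈ C × InstanceOf A B)
           × ((B′ : Prop) → B′ ∈ C → InstanceOf A B′ → B′ ≡ B))
lemma7 nS nΓ I small-step =
  saturate I , simpleProps ,
  (λ A → saturate-complete , saturate-sound) ,
  saturate-conclusions (All.map small-step-shallow small-step) ,
  unique-simple-pattern
  where open Saturation nS nΓ
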